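{- Let $n\ge 0$ and $k\ge 1$ be integers. The number of terms in the multisum \[ \sum_{m_k=0}^{U_k} \sum_{m_{k-1}=0}^{U_{k-1}} \cdots \sum_{m_2=0}^{U_2} \Bigl( 1+n-k^2 - \sum_{h=2}^k h m_h \Bigr) \prod_{i=2}^k (m_i + 1), \qquad U_j = \left\lfloor \frac{ n-k^2 - \sum_{h=j+1}^k h m_h}{j} \right\rfloor, \] equals $r_1(n,k)$, the number of partitions of $n$ into exactly $k$ parts which mutually differ by at least $2$. The multisum is a formula for the number $D(n,k)$ of partitions of $n$ with Durfee square of order $k$. Its terms are indexed by the $k$-tuples $(m_1,\dots,m_k)$ of nonnegative integers with $\sum_{h=1}^k h m_h=n-k^2$, where $m_1$ is determined by $m_2,\dots,m_k$.
   Context: Empty sums (upper limit below lower limit) contribute no terms. -}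

module Defs where

open import Data.Nat using (ℕ; zero; suc; _+_; _*_; _∸_; _≤_; _≤ᵇ_; _/_)
open import Data.Bool using (if_then_else_)
open import Data.List using (List; length)
open import Data.Nat.ListAction using (sum)
open import Data.List.Relation.Unary.All using (All)
open import Data.List.Relation.Unary.Linked using (Linked)
open import Data.Product using (Σ; _×_)
open import Relation.Binary.PropositionalEquality using (_≡_)

sumTo : ℕ → (ℕ → ℕ) → ℕ
sumTo zero    f = f 0
sumTo (suc u) f = sumTo u f + f (suc u)

-- nest j R : number of terms of the nested sum
--   Σ_{m_j=0}^{⌊R/j⌋} Σ_{m_{j-1}=0}^{U_{j-1}} ... Σ_{m_2=0}^{U_2} (term)
-- where R = n - k² - Σ_{h>j} h m_h is the current (nonnegative) remainder,
-- and U_{i} = ⌊(R - j m_j - ... - (i+1) m_{i+1}) / i⌋.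
nest : ℕ → ℕ → ℕ
nest zero          R = 1
nest (suc zero)    R = 1
nest (suc (suc j)) R =
  sumTo (R / suc (suc j)) (λ m → nest (suc j) (R ∸ suc (suc j) * m))

-- Number of terms of the multisum for given n, k.
-- If n < k², the outermost upper limit U_k is negative, so the sum is empty
-- (and, for k = 1, there is no index tuple with m_1 = n - 1 < 0).
termCount : ℕ → ℕ → ℕ
termCount n k = if k * k ≤ᵇ n then nest k (n ∸ k * k) else 0

Gap2Partition : ℕ → ℕ → Set
Gap2Partition n k =
  Σ (List ℕ) (λ ps →
    (length ps ≡ k) × (sum ps ≡ n) × All (λ p → 1 ≤ p) ps
      × Linked (λ a b → b + 2 ≤ a) ps)

-- The proof composes three explicit bijections.
--  1. Unfolding the nested sums: Fin (Σ_{m=0}^{u} f m) ↔ Σ_{m ≤ u} Fin (f m),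
--     applied level by level, identifies the terms of  nest k R  with the
--     multiplicity lists (m_k, …, m_1) of length k whose weighted sum
--     Σ_h h·m_h equals R  (m_1 being the forced last entry).
--  2. A multiplicity list of weight n - k² determines the increasing parts
--     q_k = 1 + m_k,  q_{i} = q_{i+1} + 2 + m_i,  of total n; conversely the
--     gaps of an increasing 2-gapped list of parts ≥ 1 recover the m_h.
--  3. Reversing the increasing list gives the decreasing list of parts used
--     in  Gap2Partition.
-- For n < k² both sides are empty: every gap-2 partition into k parts has
-- n ≥ k², by the weight identity of step 2.
module Submission where

open import Defs
open import Data.Nat using (ℕ; _≤_)
open import Data.Fin using (Fin)
open import Function.Bundles using (_↔_)

open import Data.Nat using (zero; suc; _+_; _*_; _∸_; _/_; _≤ᵇ_; z≤n; s≤s; NonZero)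
open import Data.Nat.Properties
open import Data.Nat.DivMod using (m/n*n≤m; m*n/n≡m; /-monoˡ-≤)
open import Data.Nat.ListAction using (sum)
open import Data.Nat.ListAction.Properties using (sum-↭)
open import Data.Nat.Tactic.RingSolver using (solve-∀)
open import Data.Fin.Properties using (+↔⊎)
open import Data.Bool using (true; false)
open import Data.List using (List; []; _∷_; length; reverse; _ʳ++_)
open import Data.List.Properties using (length-reverse; reverse-involutive)
open import Data.List.Relation.Unary.All as All using (All; []; _∷_)
open import Data.List.Relation.Unary.Linked as Linked using (Linked; []; [-]; _∷_)
open import Data.List.Relation.Unary.Linked.Properties using (Linked⇒All)
open import Data.List.Relation.Binary.Permutation.Propositional using (↭-sym)
open import Data.List.Relation.Binary.Permutation.Propositional.Properties
  using (↭-reverse; All-resp-↭)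
open import Data.Product using (Σ; _×_; _,_; proj₁)
open import Data.Sum using (_⊎_; inj₁; inj₂)
open import Data.Sum.Function.Propositional using (_⊎-↔_)
open import Data.Product.Function.NonDependent.Propositional using (_×-↔_)
open import Data.Product.Function.Dependent.Propositional using (Σ-↔)
open import Function using (flip)
open import Function.Bundles using (mk↔ₛ′)
open import Function.Properties.Inverse using (↔-trans; ↔-refl)
open import Relation.Binary using (Rel)
open import Relation.Binary.PropositionalEquality
open import Relation.Nullary using (¬_; yes; no; contradiction)

Fin-cast : ∀ {c d} {A : Set} → c ≡ d → Fin d ↔ A → Fin c ↔ A
Fin-cast refl c↔A = c↔A

Bounded : ℕ → (ℕ → Set) → Set
Bounded u A = Σ ℕ (λ m → m ≤ u × A m)

Bounded-cong : ∀ {u A B} → (∀ m → A m ↔ B m) → Bounded u A ↔ Bounded u B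
Bounded-cong A↔B = Σ-↔ ↔-refl (↔-refl ×-↔ A↔B _)

sumTo-suc : ∀ u f → sumTo (suc u) f ≡ f 0 + sumTo u (λ m → f (suc m))
sumTo-suc zero    f = refl
sumTo-suc (suc u) f = begin
  sumTo (suc u) f + f (suc (suc u))
    ≡⟨ cong (_+ f (suc (suc u))) (sumTo-suc u f) ⟩
  f 0 + sumTo u (λ m → f (suc m)) + f (suc (suc u))
    ≡⟨ +-assoc (f 0) _ _ ⟩
  f 0 + sumTo (suc u) (λ m → f (suc m)) ∎
  where open ≡-Reasoning

Bounded-zero : ∀ A → A 0 ↔ Bounded 0 A
Bounded-zero A = mk↔ₛ′ (λ x → 0 , z≤n , x) (λ { (0 , z≤n , x) → x })
  (λ { (0 , z≤n , x) → refl }) (λ _ → refl)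

Bounded-suc : ∀ u A → (A 0 ⊎ Bounded u (λ m → A (suc m))) ↔ Bounded (suc u) A
Bounded-suc u A = mk↔ₛ′ to from to∘from from∘to
  where
  to : A 0 ⊎ Bounded u (λ m → A (suc m)) → Bounded (suc u) A
  to (inj₁ x)           = 0 , z≤n , x
  to (inj₂ (m , p , x)) = suc m , s≤s p , x
  from : Bounded (suc u) A → A 0 ⊎ Bounded u (λ m → A (suc m))
  from (0     , z≤n   , x) = inj₁ x
  from (suc m , s≤s p , x) = inj₂ (m , p , x)
  to∘from : ∀ y → to (from y) ≡ y
  to∘from (0     , z≤n   , x) = refl
  to∘from (suc m , s≤s p , x) = refl
  from∘to : ∀ y → from (to y) ≡ y
  from∘to (inj₁ x) = refl
  from∘to (inj₂ y) = refl

Fin-sumTo↔ : ∀ u f → Fin (sumTo u f) ↔ Bounded u (λ m → Fin (f m))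
Fin-sumTo↔ zero    f = Bounded-zero (λ m → Fin (f m))
Fin-sumTo↔ (suc u) f =
  Fin-cast (sumTo-suc u f)
    (↔-trans +↔⊎
      (↔-trans (↔-refl ⊎-↔ Fin-sumTo↔ u (λ m → f (suc m)))
        (Bounded-suc u (λ m → Fin (f m)))))

-- The weighted sum Σ_h h·m_h of a multiplicity list (m_k, …, m_1): the entry
-- followed by L further entries has weight L + 1.
weight : List ℕ → ℕ
weight []       = 0
weight (m ∷ ms) = suc (length ms) * m + weight ms

weight-singleton : ∀ m → weight (m ∷ []) ≡ m
weight-singleton m = trans (+-identityʳ (1 * m)) (*-identityˡ m)

Mult : ℕ → ℕ → Set
Mult k R = Σ (List ℕ) (λ ms → length ms ≡ k × weight ms ≡ R)

Mult-≡ : ∀ {k R} {x y : Mult k R} → proj₁ x ≡ proj₁ y → x ≡ y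
Mult-≡ {x = ms , len , wt} {.ms , len′ , wt′} refl =
  cong₂ (λ p q → ms , p , q) (≡-irrelevant len len′) (≡-irrelevant wt wt′)

≤-quotient⇒ : ∀ {m R d} .{{_ : NonZero d}} → m ≤ R / d → d * m ≤ R
≤-quotient⇒ {m} {R} {d} m≤R/d = begin
  d * m     ≡⟨ *-comm d m ⟩
  m * d     ≤⟨ *-monoˡ-≤ d m≤R/d ⟩
  R / d * d ≤⟨ m/n*n≤m R d ⟩
  R         ∎
  where open ≤-Reasoning

⇒≤-quotient : ∀ {m R d} .{{_ : NonZero d}} → d * m ≤ R → m ≤ R / d
⇒≤-quotient {m} {R} {d} dm≤R = begin
  m         ≡⟨ m*n/n≡m m d ⟨
  m * d / d ≤⟨ /-monoˡ-≤ d (subst (_≤ R) (*-comm d m) dm≤R) ⟩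
  R / d     ∎
  where open ≤-Reasoning

Mult-one : ∀ R → Fin 1 ↔ Mult 1 R
Mult-one R = mk↔ₛ′ (λ _ → R ∷ [] , refl , weight-singleton R) (λ _ → Fin.zero)
  unique (λ { Fin.zero → refl ; (Fin.suc ()) })
  where
  unique : ∀ y → (R ∷ [] , refl , weight-singleton R) ≡ y
  unique (m ∷ [] , refl , wt) = Mult-≡ (cong (_∷ []) (trans (sym wt) (weight-singleton m)))

Mult-cons : ∀ k R → Bounded (R / suc k) (λ m → Mult k (R ∸ suc k * m)) ↔ Mult (suc k) R
Mult-cons k R = mk↔ₛ′ to from to∘from from∘to
  where
  to : Bounded (R / suc k) (λ m → Mult k (R ∸ suc k * m)) → Mult (suc k) R
  to (m , m≤ , ms , len , wt) = m ∷ ms , cong suc len , (begin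
    suc (length ms) * m + weight ms ≡⟨ cong (λ L → suc L * m + weight ms) len ⟩
    suc k * m + weight ms           ≡⟨ cong (suc k * m +_) wt ⟩
    suc k * m + (R ∸ suc k * m)     ≡⟨ m+[n∸m]≡n (≤-quotient⇒ m≤) ⟩
    R                               ∎)
    where open ≡-Reasoning

  from : Mult (suc k) R → Bounded (R / suc k) (λ m → Mult k (R ∸ suc k * m))
  from (m ∷ ms , len , wt) =
    m , ⇒≤-quotient (subst (suc k * m ≤_) wt′ (m≤m+n _ _)) , ms , len′ ,
    trans (sym (m+n∸m≡n (suc k * m) (weight ms))) (cong (_∸ suc k * m) wt′)
    where
    len′ : length ms ≡ k
    len′ = suc-injective len
    wt′ : suc k * m + weight ms ≡ R
    wt′ = trans (cong (λ L → suc L * m + weight ms) (sym len′)) wt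

  to∘from : ∀ y → to (from y) ≡ y
  to∘from (_ ∷ _ , _ , _) = Mult-≡ refl

  from∘to : ∀ y → from (to y) ≡ y
  from∘to (m , _ , _) = cong₂ (λ p x → m , p , x) (≤-irrelevant _ _) (Mult-≡ refl)

Fin-nest↔Mult : ∀ j R → Fin (nest (suc j) R) ↔ Mult (suc j) R
Fin-nest↔Mult zero    R = Mult-one R
Fin-nest↔Mult (suc j) R =
  ↔-trans (Fin-sumTo↔ (R / suc (suc j)) _)
    (↔-trans (Bounded-cong (λ m → Fin-nest↔Mult j (R ∸ suc (suc j) * m)))
      (Mult-cons (suc j) R))

Gap2 : ℕ → ℕ → Set
Gap2 a b = b + 2 ≤ a

Gap2-trans : ∀ {a b c} → Gap2 a b → Gap2 b c → Gap2 a c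
Gap2-trans {b = b} b+2≤a c+2≤b = ≤-trans c+2≤b (≤-trans (m≤m+n b 2) b+2≤a)

partsFrom : ℕ → List ℕ → List ℕ
partsFrom b []       = []
partsFrom b (m ∷ ms) = b + m ∷ partsFrom (b + m + 2) ms

gapsFrom : ℕ → List ℕ → List ℕ
gapsFrom b []       = []
gapsFrom b (q ∷ qs) = q ∸ b ∷ gapsFrom (q + 2) qs

length-partsFrom : ∀ b ms → length (partsFrom b ms) ≡ length ms
length-partsFrom b []       = refl
length-partsFrom b (m ∷ ms) = cong suc (length-partsFrom (b + m + 2) ms)

length-gapsFrom : ∀ b qs → length (gapsFrom b qs) ≡ length qs
length-gapsFrom b []       = refl
length-gapsFrom b (q ∷ qs) = cong suc (length-gapsFrom (q + 2) qs)

partsFrom-bounded : ∀ b ms → All (b ≤_) (partsFrom b ms)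
partsFrom-bounded b []       = []
partsFrom-bounded b (m ∷ ms) =
  m≤m+n b m ∷ All.map (≤-trans (≤-trans (m≤m+n b m) (m≤m+n (b + m) 2)))
                      (partsFrom-bounded (b + m + 2) ms)

partsFrom-increasing : ∀ b ms → Linked (flip Gap2) (partsFrom b ms)
partsFrom-increasing b []            = []
partsFrom-increasing b (m ∷ [])      = [-]
partsFrom-increasing b (m ∷ m′ ∷ ms) =
  m≤m+n (b + m + 2) m′ ∷ partsFrom-increasing (b + m + 2) (m′ ∷ ms)

sum-partsFrom : ∀ c ms →
  sum (partsFrom (suc c) ms) ≡ length ms * c + length ms * length ms + weight ms
sum-partsFrom c []       = refl
sum-partsFrom c (m ∷ ms) =
  trans (cong (suc c + m +_) (sum-partsFrom (c + m + 2) ms))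
        (regroup c m (length ms) (weight ms))
  where
  regroup : ∀ c m L w → suc c + m + (L * (c + m + 2) + L * L + w)
                      ≡ suc L * c + suc L * suc L + (suc L * m + w)
  regroup = solve-∀

sum-partsFrom-1 : ∀ ms → sum (partsFrom 1 ms) ≡ length ms * length ms + weight ms
sum-partsFrom-1 ms =
  trans (sum-partsFrom 0 ms) (cong (λ z → z + L * L + weight ms) (*-zeroʳ L))
  where L = length ms

gapsFrom-partsFrom : ∀ b ms → gapsFrom b (partsFrom b ms) ≡ ms
gapsFrom-partsFrom b []       = refl
gapsFrom-partsFrom b (m ∷ ms) =
  cong₂ _∷_ (m+n∸m≡n b m) (gapsFrom-partsFrom (b + m + 2) ms)

partsFrom-gapsFrom : ∀ b qs → All (b ≤_) qs → Linked (flip Gap2) qs →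
                     partsFrom b (gapsFrom b qs) ≡ qs
partsFrom-gapsFrom b []       _           _  = refl
partsFrom-gapsFrom b (q ∷ qs) (b≤q ∷ _) inc rewrite m+[n∸m]≡n b≤q =
  cong (q ∷_) (partsFrom-gapsFrom (q + 2) qs (above-head qs inc) (Linked.tail inc))
  where
  above-head : ∀ qs → Linked (flip Gap2) (q ∷ qs) → All (q + 2 ≤_) qs
  above-head []       _          = []
  above-head (_ ∷ _) (q+2≤ ∷ inc) = Linked⇒All (flip Gap2-trans) q+2≤ inc

Linked-reverse : ∀ {a ℓ} {A : Set a} {R : Rel A ℓ} {xs} →
                 Linked R xs → Linked (flip R) (reverse xs)
Linked-reverse                 []  = []
Linked-reverse {R = R} {x ∷ xs} lk = onto x xs [] lk [-]
  where
  onto : ∀ x xs acc → Linked R (x ∷ xs) → Linked (flip R) (x ∷ acc) →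
         Linked (flip R) (xs ʳ++ (x ∷ acc))
  onto x []       acc _          done = done
  onto x (y ∷ ys) acc (Rxy ∷ lk) done = onto y ys (x ∷ acc) lk (Rxy ∷ done)

All-reverse : ∀ {P : ℕ → Set} {xs} → All P xs → All P (reverse xs)
All-reverse {xs = xs} = All-resp-↭ (↭-sym (↭-reverse xs))

sum-reverse : ∀ xs → sum (reverse xs) ≡ sum xs
sum-reverse xs = sum-↭ (↭-reverse xs)

Gap2Partition-≡ : ∀ {n k} {x y : Gap2Partition n k} → proj₁ x ≡ proj₁ y → x ≡ y
Gap2Partition-≡ {x = ps , l , s , pos , gap} {.ps , l′ , s′ , pos′ , gap′} refl =
  cong₂ (λ p q → ps , p , q) (≡-irrelevant l l′)
    (cong₂ _,_ (≡-irrelevant s s′)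
      (cong₂ _,_ (All.irrelevant ≤-irrelevant pos pos′)
                 (Linked.irrelevant ≤-irrelevant gap gap′)))

gaps : ∀ {n k} → Gap2Partition n k → List ℕ
gaps (ps , _) = gapsFrom 1 (reverse ps)

partsFrom-gaps : ∀ {n k} (p : Gap2Partition n k) →
                 partsFrom 1 (gaps p) ≡ reverse (proj₁ p)
partsFrom-gaps (ps , _ , _ , pos , gap) =
  partsFrom-gapsFrom 1 (reverse ps) (All-reverse pos) (Linked-reverse gap)

length-gaps : ∀ {n k} (p : Gap2Partition n k) → length (gaps p) ≡ k
length-gaps (ps , len , _) =
  trans (length-gapsFrom 1 (reverse ps)) (trans (length-reverse ps) len)

Gap2Partition-weight : ∀ {n k} (p : Gap2Partition n k) → k * k + weight (gaps p) ≡ n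
Gap2Partition-weight {n} {k} p@(ps , _ , total , _) = begin
  k * k + weight ms             ≡⟨ cong (λ L → L * L + weight ms) (length-gaps p) ⟨
  L * L + weight ms             ≡⟨ sum-partsFrom-1 ms ⟨
  sum (partsFrom 1 ms)          ≡⟨ cong sum (partsFrom-gaps p) ⟩
  sum (reverse ps)              ≡⟨ sum-reverse ps ⟩
  sum ps                        ≡⟨ total ⟩
  n                             ∎
  where
  open ≡-Reasoning
  ms = gaps p
  L = length ms

Mult↔Gap2Partition : ∀ {k R n} → k * k + R ≡ n → Mult k R ↔ Gap2Partition n k
Mult↔Gap2Partition {k} {R} {n} k²+R≡n = mk↔ₛ′ to from to∘from from∘to
  where
  to : Mult k R → Gap2Partition n k
  to (ms , len , wt) =
    reverse qs ,
    trans (length-reverse qs) (trans (length-partsFrom 1 ms) len) ,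
    (begin
      sum (reverse qs)                                ≡⟨ sum-reverse qs ⟩
      sum qs                                          ≡⟨ sum-partsFrom-1 ms ⟩
      length ms * length ms + weight ms               ≡⟨ cong₂ (λ L w → L * L + w) len wt ⟩
      k * k + R                                       ≡⟨ k²+R≡n ⟩
      n                                               ∎) ,
    All-reverse (partsFrom-bounded 1 ms) ,
    Linked-reverse (partsFrom-increasing 1 ms)
    where
    open ≡-Reasoning
    qs = partsFrom 1 ms

  from : Gap2Partition n k → Mult k R
  from p = gaps p , length-gaps p ,
    +-cancelˡ-≡ (k * k) _ _ (trans (Gap2Partition-weight p) (sym k²+R≡n))

  to∘from : ∀ p → to (from p) ≡ p
  to∘from p = Gap2Partition-≡
    (trans (cong reverse (partsFrom-gaps p)) (reverse-involutive (proj₁ p)))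

  from∘to : ∀ m → from (to m) ≡ m
  from∘to (ms , _) = Mult-≡
    (trans (cong (gapsFrom 1) (reverse-involutive (partsFrom 1 ms)))
           (gapsFrom-partsFrom 1 ms))

termCount-≤ : ∀ {n k} → k * k ≤ n → termCount n k ≡ nest k (n ∸ k * k)
termCount-≤ {n} {k} k²≤n with k * k ≤ᵇ n | ≤⇒≤ᵇ k²≤n
... | true  | _  = refl
... | false | ()

termCount-≰ : ∀ {n k} → ¬ k * k ≤ n → termCount n k ≡ 0
termCount-≰ {n} {k} k²≰n with k * k ≤ᵇ n | ≤ᵇ⇒≤ (k * k) n
... | true  | k²≤n = contradiction (k²≤n _) k²≰n
... | false | _    = refl

Fin0↔empty : ∀ {A : Set} → ¬ A → Fin 0 ↔ A
Fin0↔empty ¬A = mk↔ₛ′ (λ ()) (λ a → contradiction a ¬A) (λ a → contradiction a ¬A) (λ ())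

mainTheorem5 : (n k : ℕ) → 1 ≤ k → Fin (termCount n k) ↔ Gap2Partition n k
mainTheorem5 n zero       ()
mainTheorem5 n k@(suc j) _ with k * k ≤? n
... | yes k²≤n = Fin-cast (termCount-≤ {n} {k} k²≤n)
  (↔-trans (Fin-nest↔Mult j (n ∸ k * k)) (Mult↔Gap2Partition (m+[n∸m]≡n k²≤n)))
... | no k²≰n = Fin-cast (termCount-≰ {n} {k} k²≰n)
  (Fin0↔empty (λ p → k²≰n (subst (k * k ≤_) (Gap2Partition-weight p) (m≤m+n _ _))))
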